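{- Let $G$ be a hamiltonian threshold graph. Then every key edge of $G$ lies in at least one Hamilton cycle of $G$.
   Context: A finite simple graph $G$ is a threshold graph if there exist a function $f:V(G)\to\mathbb{R}$ with nonnegative values and a nonnegative real number $t$ such that for any two distinct vertices $u,v$, $u$ and $v$ are adjacent if and only if $f(u)+f(v)>t$. Degree partition: if the distinct positive vertex degrees of $G$ are $\delta_1<\cdots<\delta_m$, let $D_i=\{v\in V(G):\deg(v)=\delta_i\}$ for $i=1,\ldots,m$. For $S,T\subseteq V(G)$ (not necessarily disjoint), $[S,T]$ denotes the set of edges of $G$ with one end in $S$ and the other end in $T$. An edge of a threshold graph $G$ is a key edge if it lies in $[D_k,D_{m+1-k}]$ for some $k$ with $1\le k\le\lceil m/2\rceil$.
   Formalization: The nonnegative function f and the threshold t defining a threshold graph take rational values rather than real ones. -}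

module Defs where

open import Data.Bool using (Bool; true; false; if_then_else_)
open import Data.Nat using (ℕ; zero; suc; _+_; _*_; _∸_; _≤_; _<_; ⌈_/2⌉)
open import Data.Nat.Properties using (_<?_)
open import Data.Fin using (Fin; toℕ; fromℕ<)
open import Data.Fin.Permutation using (Permutation′; _⟨$⟩ʳ_)
open import Data.List using (List; map; allFin)
open import Data.Nat.ListAction using (sum)
open import Data.Product using (Σ; ∃; _×_; _,_)
open import Data.Sum using (_⊎_)
open import Data.Rational using (ℚ; 0ℚ) renaming (_+_ to _+ℚ_; _≤_ to _≤ℚ_; _<_ to _<ℚ_)
open import Relation.Nullary using (¬_; yes; no)
open import Relation.Binary.PropositionalEquality using (_≡_; _≢_)
open import Function.Bundles using (_⇔_)

record Graph (n : ℕ) : Set where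
  field
    adj     : Fin n → Fin n → Bool
    symm    : ∀ u v → adj u v ≡ adj v u
    irrefl  : ∀ v → adj v v ≡ false

open Graph public

Adj : ∀ {n} → Graph n → Fin n → Fin n → Set
Adj G u v = adj G u v ≡ true

deg : ∀ {n} → Graph n → Fin n → ℕ
deg {n} G v = sum (map (λ w → if adj G v w then 1 else 0) (allFin n))

IsThreshold : ∀ {n} → Graph n → Set
IsThreshold {n} G =
  Σ (Fin n → ℚ) λ f → Σ ℚ λ t →
    (∀ v → 0ℚ ≤ℚ f v) × (0ℚ ≤ℚ t) ×
    (∀ u v → u ≢ v → (Adj G u v ⇔ (t <ℚ (f u +ℚ f v))))

cyc : ∀ {n} → Fin n → Fin n
cyc {suc n} i with suc (toℕ i) <? suc n
... | yes p = fromℕ< p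
... | no _  = Fin.zero

record HamiltonCycle {n : ℕ} (G : Graph n) : Set where
  field
    three≤n : 3 ≤ n
    σ       : Permutation′ n
    consec  : ∀ i → Adj G (σ ⟨$⟩ʳ i) (σ ⟨$⟩ʳ cyc i)

EdgeIn : ∀ {n} {G : Graph n} → HamiltonCycle G → Fin n → Fin n → Set
EdgeIn C u v = ∃ λ i →
  ((HamiltonCycle.σ C ⟨$⟩ʳ i ≡ u) × (HamiltonCycle.σ C ⟨$⟩ʳ cyc i ≡ v)) ⊎
  ((HamiltonCycle.σ C ⟨$⟩ʳ i ≡ v) × (HamiltonCycle.σ C ⟨$⟩ʳ cyc i ≡ u))

-- δ₁ < ⋯ < δₘ (indices 1..m) are exactly the distinct positive degrees of G
IsDegreeSeq : ∀ {n} → Graph n → (m : ℕ) → (ℕ → ℕ) → Set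
IsDegreeSeq {n} G m δ =
  (∀ i j → 1 ≤ i → i < j → j ≤ m → δ i < δ j) ×
  (∀ i → 1 ≤ i → i ≤ m → (0 < δ i) × (∃ λ v → deg G v ≡ δ i)) ×
  (∀ v → 0 < deg G v → ∃ λ i → (1 ≤ i) × (i ≤ m) × (deg G v ≡ δ i))

-- key edge: uv is an edge in [D_k, D_{m+1-k}] for some 1 ≤ k ≤ ⌈m/2⌉
-- (D_i = vertices of degree δ i)
IsKeyEdge : ∀ {n} → Graph n → (m : ℕ) → (ℕ → ℕ) → Fin n → Fin n → Set
IsKeyEdge G m δ u v =
  Adj G u v ×
  (∃ λ k → (1 ≤ k) × (k ≤ ⌈ m /2⌉) ×
     (((deg G u ≡ δ k) × (deg G v ≡ δ (suc m ∸ k))) ⊎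
      ((deg G v ≡ δ k) × (deg G u ≡ δ (suc m ∸ k)))))

module Submission where

-- Let uv be a key edge, deg u = δ k and deg v = δ (m + 1 − k), and let C be a
-- Hamilton cycle in which u is followed by x and v by y.  Then x ~ y: in a
-- threshold graph neighbourhoods are nested by degree (degree-domination),
-- which forces every neighbour of a vertex in D_k to have degree at least
-- δ (m + 1 − k) (neighbour-degree); so deg x ≥ deg v, x dominates v, and x
-- is adjacent to y.  The 2-opt exchange that removes ux, vy and inserts uv,
-- xy (reversing the arc of C from x to v) then yields a Hamilton cycle
-- through uv.

open import Defs
open import Algebra.Properties.CommutativeMonoid.Sum using (sum; sum-permute)
open import Data.Bool using (true; false; if_then_else_)
open import Data.Nat using (ℕ; zero; suc; _+_; _∸_; _≤_; _<_; z≤n; s≤s; s≤s⁻¹)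
import Data.Nat as ℕ
open import Data.Nat.Properties hiding (_≟_)
open import Data.Fin using (Fin; toℕ; fromℕ<; _≟_)
open import Data.Fin.Properties using (toℕ-injective; toℕ-fromℕ<; toℕ<n)
open import Data.Fin.Permutation
  using (Permutation′; _⟨$⟩ʳ_; _⟨$⟩ˡ_; permutation; _∘ₚ_; transpose; inverseˡ; inverseʳ)
open import Data.List using (tabulate)
open import Data.List.Properties using (map-tabulate)
import Data.Nat.ListAction as List
open import Data.Product using (Σ; ∃; _×_; _,_; proj₁; proj₂)
open import Data.Sum using (_⊎_; inj₁; inj₂; map₂; [_,_])
open import Data.Empty using (⊥-elim)
open import Relation.Nullary using (¬_; yes; no)
open import Relation.Nullary.Decidable using (_×-dec_)
open import Relation.Binary.PropositionalEquality
  using (_≡_; _≢_; refl; sym; trans; cong; subst; subst₂; ≢-sym; module ≡-Reasoning)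
open import Relation.Binary.Definitions using (tri<; tri≈; tri>)
open import Function.Bundles using (Equivalence; _⇔_)
import Data.Rational as ℚ
import Data.Rational.Properties as ℚ

open HamiltonCycle using (σ; consec)

∑ : ∀ {n} → (Fin n → ℕ) → ℕ
∑ = sum +-0-commutativeMonoid

∑-mono : ∀ {n} {g h : Fin n → ℕ} → (∀ i → g i ≤ h i) → ∑ g ≤ ∑ h
∑-mono {zero}  g≤h = z≤n
∑-mono {suc n} g≤h = +-mono-≤ (g≤h Fin.zero) (∑-mono (λ i → g≤h (Fin.suc i)))

term≤∑ : ∀ {n} (g : Fin n → ℕ) i → g i ≤ ∑ g
term≤∑ g Fin.zero    = m≤m+n _ _
term≤∑ g (Fin.suc i) = ≤-trans (term≤∑ (λ j → g (Fin.suc j)) i) (m≤n+m _ _)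

∑-tight : ∀ {n} {g h : Fin n → ℕ} → (∀ i → g i ≤ h i) → ∑ h ≤ ∑ g → ∀ i → h i ≤ g i
∑-tight {suc n} {g} {h} g≤h tot Fin.zero =
  +-cancelʳ-≤ _ _ _ (≤-trans tot (+-monoʳ-≤ (g Fin.zero) (∑-mono (λ i → g≤h (Fin.suc i)))))
∑-tight {suc n} {g} {h} g≤h tot (Fin.suc i) =
  ∑-tight (λ i → g≤h (Fin.suc i)) (+-cancelˡ-≤ _ _ _ (≤-trans tot (+-monoˡ-≤ _ (g≤h Fin.zero)))) i

listSum-tabulate : ∀ {n} (g : Fin n → ℕ) → List.sum (tabulate g) ≡ ∑ g
listSum-tabulate {zero}  g = refl
listSum-tabulate {suc n} g = cong (g Fin.zero +_) (listSum-tabulate (λ i → g (Fin.suc i)))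

transpose-fixes : ∀ {n} {i j k : Fin n} → k ≢ i → k ≢ j → transpose i j ⟨$⟩ʳ k ≡ k
transpose-fixes {i = i} {j} {k} k≢i k≢j with k ≟ i
... | yes k≡i = ⊥-elim (k≢i k≡i)
... | no _ with k ≟ j
...   | yes k≡j = ⊥-elim (k≢j k≡j)
...   | no _ = refl

module Neighbourhoods {n : ℕ} (G : Graph n) where

  adj-sym : ∀ {a b} → Adj G a b → Adj G b a
  adj-sym {a} {b} ab = trans (symm G b a) ab

  adj-irrefl : ∀ {a b} → Adj G a b → a ≢ b
  adj-irrefl {a} ab refl with trans (sym (irrefl G a)) ab
  ... | ()

  nbr : Fin n → Fin n → ℕ
  nbr a w = if adj G a w then 1 else 0

  deg≡∑ : ∀ a → deg G a ≡ ∑ (nbr a)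
  deg≡∑ a = trans (cong List.sum (map-tabulate (λ w → w) (nbr a))) (listSum-tabulate (nbr a))

  nbr-mono : ∀ {a b w} → (Adj G a w → Adj G b w) → nbr a w ≤ nbr b w
  nbr-mono {a} {b} {w} imp with adj G a w | adj G b w
  ... | false | _     = z≤n
  ... | true  | true  = ≤-refl
  ... | true  | false with imp refl
  ...   | ()

  nbr-reflect : ∀ {a b w} → nbr b w ≤ nbr a w → Adj G b w → Adj G a w
  nbr-reflect {a} {b} {w} le bw with adj G a w | adj G b w
  nbr-reflect le bw  | true  | _     = refl
  nbr-reflect () bw  | false | true
  nbr-reflect le ()  | false | false

  nbr-self : ∀ a → nbr a a ≡ 0
  nbr-self a rewrite irrefl G a = refl

  nbr-sym : ∀ a b → nbr a b ≡ nbr b a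
  nbr-sym a b rewrite symm G a b = refl

  Dominated : Fin n → Fin n → Set
  Dominated a b = ∀ z → z ≢ b → Adj G a z → Adj G b z

  -- Pairing w with its image under the transposition (a b) compares the
  -- adjacency indicators of a and b term by term.
  nbr-transposed : ∀ {a b} → Dominated a b → ∀ w → nbr a w ≤ nbr b (transpose a b ⟨$⟩ʳ w)
  nbr-transposed {a} {b} dom w with w ≟ a
  ... | yes refl = ≤-reflexive (trans (nbr-self a) (sym (nbr-self b)))
  ... | no _ with w ≟ b
  ...   | yes refl = ≤-reflexive (nbr-sym a b)
  ...   | no w≢b = nbr-mono (dom w w≢b)

  dominated⇒deg≤ : ∀ {a b} → Dominated a b → deg G a ≤ deg G b
  dominated⇒deg≤ {a} {b} dom = begin
    deg G a                               ≡⟨ deg≡∑ a ⟩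
    ∑ (nbr a)                             ≤⟨ ∑-mono (nbr-transposed dom) ⟩
    ∑ (λ w → nbr b (transpose a b ⟨$⟩ʳ w)) ≡⟨ sum-permute +-0-commutativeMonoid (nbr b) (transpose a b) ⟨
    ∑ (nbr b)                             ≡⟨ deg≡∑ b ⟨
    deg G b                               ∎
    where open ≤-Reasoning

  -- ... and if b has no larger degree either, the domination goes both ways:
  -- the term-by-term comparison above must then be tight.
  dominated-converse : ∀ {a b} → Dominated a b → deg G b ≤ deg G a → Dominated b a
  dominated-converse {a} {b} dom b≤a z z≢a bz =
    nbr-reflect (subst (λ x → nbr b x ≤ nbr a z) (transpose-fixes z≢a z≢b) pointwise) bz
    where
    z≢b : z ≢ b
    z≢b z≡b = adj-irrefl bz (sym z≡b)
    total : ∑ (λ w → nbr b (transpose a b ⟨$⟩ʳ w)) ≤ ∑ (nbr a)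
    total = begin
      ∑ (λ w → nbr b (transpose a b ⟨$⟩ʳ w)) ≡⟨ sum-permute +-0-commutativeMonoid (nbr b) (transpose a b) ⟨
      ∑ (nbr b)                             ≡⟨ deg≡∑ b ⟨
      deg G b                               ≤⟨ b≤a ⟩
      deg G a                               ≡⟨ deg≡∑ a ⟩
      ∑ (nbr a)                             ∎
      where open ≤-Reasoning
    pointwise : nbr b (transpose a b ⟨$⟩ʳ z) ≤ nbr a z
    pointwise = ∑-tight (nbr-transposed dom) total z

  adj⇒deg-pos : ∀ {a w} → Adj G a w → 0 < deg G a
  adj⇒deg-pos {a} {w} aw = begin
    1                 ≡⟨ cong (λ b → if b then 1 else 0) aw ⟨
    nbr a w           ≤⟨ term≤∑ (nbr a) w ⟩
    ∑ (nbr a)         ≡⟨ deg≡∑ a ⟨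
    deg G a           ∎
    where open ≤-Reasoning

module Threshold {n : ℕ} (G : Graph n) (thr : IsThreshold G) where
  open Neighbourhoods G

  private
    f : Fin n → ℚ.ℚ
    f = proj₁ thr

    t : ℚ.ℚ
    t = proj₁ (proj₂ thr)

    adj⇔ : ∀ a b → a ≢ b → Adj G a b ⇔ (t ℚ.< f a ℚ.+ f b)
    adj⇔ = proj₂ (proj₂ (proj₂ (proj₂ thr)))

  weight-domination : ∀ {a b} → f a ℚ.≤ f b → Dominated a b
  weight-domination {a} {b} fa≤fb z z≢b az =
    Equivalence.from (adj⇔ b z (≢-sym z≢b))
      (ℚ.<-≤-trans (Equivalence.to (adj⇔ a z (adj-irrefl az)) az) (ℚ.+-monoˡ-≤ (f z) fa≤fb))

  degree-domination : ∀ {a b} → deg G a ≤ deg G b → Dominated a b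
  degree-domination {a} {b} a≤b with ℚ.≤-total (f a) (f b)
  ... | inj₁ fa≤fb = weight-domination fa≤fb
  ... | inj₂ fb≤fa = dominated-converse (weight-domination fb≤fa) a≤b

  degree-squeeze : ∀ {z z' w} → deg G z ≤ deg G z' → Adj G w z →
    (∀ {y} → Adj G z' y → deg G w ≤ deg G y) → deg G z ≡ deg G z'
  degree-squeeze {z} {z'} {w} z≤z' wz w≤nbr = ≤-antisym z≤z' (dominated⇒deg≤ z'-dominated)
    where
    z'-dominated : Dominated z' z
    z'-dominated y y≢z z'y = adj-sym (degree-domination (w≤nbr z'y) z (≢-sym y≢z) wz)

module DegreePartition {n : ℕ} (G : Graph n) (thr : IsThreshold G)
                       {m : ℕ} {δ : ℕ → ℕ} (ds : IsDegreeSeq G m δ) where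
  open Neighbourhoods G
  open Threshold G thr

  private
    δ-strict : ∀ i j → 1 ≤ i → i < j → j ≤ m → δ i < δ j
    δ-strict = proj₁ ds

    realised : ∀ i → 1 ≤ i → i ≤ m → (0 < δ i) × (∃ λ v → deg G v ≡ δ i)
    realised = proj₁ (proj₂ ds)

    classify : ∀ v → 0 < deg G v → ∃ λ i → (1 ≤ i) × (i ≤ m) × (deg G v ≡ δ i)
    classify = proj₂ (proj₂ ds)

  δ-mono : ∀ {i j} → 1 ≤ i → i ≤ j → j ≤ m → δ i ≤ δ j
  δ-mono {i} {j} 1≤i i≤j j≤m with i ℕ.≟ j
  ... | yes refl = ≤-refl
  ... | no i≢j = <⇒≤ (δ-strict i j 1≤i (≤∧≢⇒< i≤j i≢j) j≤m)

  δ₁-least : ∀ {w} → 0 < deg G w → δ 1 ≤ deg G w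
  δ₁-least {w} pos with classify w pos
  ... | i , 1≤i , i≤m , dw = subst (δ 1 ≤_) (sym dw) (δ-mono ≤-refl 1≤i i≤m)

  below-next : ∀ {w l} → 1 ≤ l → l < m → 0 < deg G w → deg G w < δ (suc l) → deg G w ≤ δ l
  below-next {w} {l} 1≤l l<m pos w<δ with classify w pos
  ... | b , 1≤b , b≤m , dw with b ≤? l
  ...   | yes b≤l = subst (_≤ δ l) (sym dw) (δ-mono 1≤b b≤l (<⇒≤ l<m))
  ...   | no b≰l = ⊥-elim (<⇒≱ w<δ (subst (δ (suc l) ≤_) (sym dw) (δ-mono (s≤s z≤n) (≰⇒> b≰l) b≤m)))

  -- By downward induction on i: if a neighbour w of z ∈ D_i had smaller degree,
  -- then w would lie below every neighbour of any z' ∈ D_{i+1} (induction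
  -- hypothesis), and degree-squeeze would force deg z = deg z', contradicting
  -- δ i < δ (i + 1).
  neighbour-degree : ∀ {i z w} → 1 ≤ i → i ≤ m → deg G z ≡ δ i → Adj G w z → δ (suc m ∸ i) ≤ deg G w
  neighbour-degree {i} 1≤i i≤m = by-gap (m ∸ i) (m+[n∸m]≡n i≤m) 1≤i
    where
    by-gap : ∀ j {i} → i + j ≡ m → 1 ≤ i → ∀ {z w} → deg G z ≡ δ i → Adj G w z → δ (suc m ∸ i) ≤ deg G w
    by-gap zero {i} i+0≡m _ {w = w} _ wz = subst (λ k → δ k ≤ deg G w) (sym top) (δ₁-least (adj⇒deg-pos wz))
      where
      top : suc m ∸ i ≡ 1
      top = trans (cong (suc m ∸_) (trans (sym (+-identityʳ i)) i+0≡m)) (m+n∸n≡m 1 m)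
    by-gap (suc j) {i} i+j≡m 1≤i {z} {w} dz wz with δ (suc m ∸ i) ≤? deg G w
    ... | yes enough = enough
    ... | no too-small = ⊥-elim (<-irrefl (trans (sym dz) (trans squeeze dz')) (δ-strict i (suc i) 1≤i ≤-refl i<m))
      where
      si+j≡m : suc i + j ≡ m
      si+j≡m = trans (sym (+-suc i j)) i+j≡m
      i<m : i < m
      i<m = subst (suc i ≤_) si+j≡m (m≤m+n (suc i) j)
      w-small : deg G w ≤ δ (m ∸ i)
      w-small = below-next (m<n⇒0<n∸m i<m) (∸-monoʳ-< 1≤i (<⇒≤ i<m)) (adj⇒deg-pos wz)
        (subst (λ k → deg G w < δ k) (+-∸-assoc 1 (<⇒≤ i<m)) (≰⇒> too-small))
      z' : Fin n
      z' = proj₁ (proj₂ (realised (suc i) (s≤s z≤n) i<m))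
      dz' : deg G z' ≡ δ (suc i)
      dz' = proj₂ (proj₂ (realised (suc i) (s≤s z≤n) i<m))
      squeeze : deg G z ≡ deg G z'
      squeeze = degree-squeeze (subst₂ _≤_ (sym dz) (sym dz') (δ-mono 1≤i (n≤1+n i) i<m)) wz
        (λ z'y → ≤-trans w-small (by-gap j si+j≡m (s≤s z≤n) dz' (adj-sym z'y)))

  -- Closure at a key edge: if deg u = δ k and deg v = δ (m + 1 − k), then for
  -- edges ux and vy with x ≠ y, also xy is an edge: x has degree at least
  -- deg v, so it dominates v.  (Any 1 ≤ k ≤ m works.)
  successors-adjacent : ∀ {k u v x y} → 1 ≤ k → k ≤ m → deg G u ≡ δ k → deg G v ≡ δ (suc m ∸ k) →
    Adj G u x → Adj G v y → x ≢ y → Adj G x y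
  successors-adjacent {x = x} 1≤k k≤m du dv ux vy x≢y =
    degree-domination (subst (_≤ deg G x) (sym dv) (neighbour-degree 1≤k k≤m du (adj-sym ux)))
      _ (≢-sym x≢y) vy

  key-edge-closure : ∀ {k u v x y} → 1 ≤ k → k ≤ m →
    (deg G u ≡ δ k × deg G v ≡ δ (suc m ∸ k)) ⊎ (deg G v ≡ δ k × deg G u ≡ δ (suc m ∸ k)) →
    Adj G u x → Adj G v y → x ≢ y → Adj G x y
  key-edge-closure 1≤k k≤m (inj₁ (du , dv)) ux vy x≢y = successors-adjacent 1≤k k≤m du dv ux vy x≢y
  key-edge-closure 1≤k k≤m (inj₂ (dv , du)) ux vy x≢y =
    adj-sym (successors-adjacent 1≤k k≤m dv du vy ux (≢-sym x≢y))

cyc-cases : ∀ {n} (i : Fin (suc n)) → toℕ (cyc i) ≡ suc (toℕ i) ⊎ (toℕ i ≡ n × toℕ (cyc i) ≡ 0)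
cyc-cases {n} i with suc (toℕ i) <? suc n
... | yes i+1<n = inj₁ (toℕ-fromℕ< i+1<n)
... | no i+1≮n = inj₂ (≤-antisym (s≤s⁻¹ (toℕ<n i)) (s≤s⁻¹ (≮⇒≥ i+1≮n)) , refl)

cyc-step : ∀ {n} (i : Fin (suc n)) → toℕ i < n → toℕ (cyc i) ≡ suc (toℕ i)
cyc-step i i<n with cyc-cases i
... | inj₁ i⁺ = i⁺
... | inj₂ (i-last , _) = ⊥-elim (<-irrefl i-last i<n)

cyc-injective : ∀ {n} {i j : Fin (suc n)} → cyc i ≡ cyc j → i ≡ j
cyc-injective {i = i} {j} eq with cyc-cases i | cyc-cases j | cong toℕ eq
... | inj₁ i⁺ | inj₁ j⁺ | e = toℕ-injective (suc-injective (trans (sym i⁺) (trans e j⁺)))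
... | inj₂ (i-last , _) | inj₂ (j-last , _) | _ = toℕ-injective (trans i-last (sym j-last))
... | inj₁ i⁺ | inj₂ (_ , j⁺) | e with trans (sym i⁺) (trans e j⁺)
...   | ()
cyc-injective {i = i} {j} eq | inj₂ (_ , i⁺) | inj₁ j⁺ | e with trans (sym j⁺) (trans (sym e) i⁺)
...   | ()

-- Let C visit σ 0, σ 1, …, σ n in this cyclic order and
-- let p < q be positions with σ p ~ σ q and σ p⁺ ~ σ q⁺ (where i⁺ = cyc i).
-- Reversing the block of positions p + 1, …, q gives the cyclic order
--   σ 0, …, σ p, σ q, σ (q − 1), …, σ (p + 1), σ q⁺, …, σ n,
-- again a Hamilton cycle, and one that uses the edge σ p σ q.
module TwoOpt {n : ℕ} {G : Graph (suc n)} (C : HamiltonCycle G) (p q : Fin (suc n))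
  (p<q : toℕ p < toℕ q)
  (pq : Adj G (σ C ⟨$⟩ʳ p) (σ C ⟨$⟩ʳ q))
  (p⁺q⁺ : Adj G (σ C ⟨$⟩ʳ cyc p) (σ C ⟨$⟩ʳ cyc q)) where

  open Neighbourhoods G using (adj-sym)

  private
    P Q : ℕ
    P = toℕ p
    Q = toℕ q

    -- positions in the block are mirrored by i ↦ W ∸ i
    W : ℕ
    W = suc P + Q

    Q≤n : Q ≤ n
    Q≤n = s≤s⁻¹ (toℕ<n q)

    P<n : P < n
    P<n = <-≤-trans p<q Q≤n

  InBlock : ℕ → Set
  InBlock i = P < i × i ≤ Q

  mirror-in-block : ∀ {i} → InBlock i → InBlock (W ∸ i)
  mirror-in-block {i} (P<i , i≤Q) =
    subst (_≤ W ∸ i) (m+n∸n≡m (suc P) Q) (∸-monoʳ-≤ W i≤Q) ,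
    subst (W ∸ i ≤_) (m+n∸m≡n (suc P) Q) (∸-monoʳ-≤ W P<i)

  mirror-mirror : ∀ {i} → InBlock i → W ∸ (W ∸ i) ≡ i
  mirror-mirror (_ , i≤Q) = m∸[m∸n]≡n (≤-trans i≤Q (m≤n+m Q (suc P)))

  -- Position i of the new cycle holds the vertex at position reflect i of C.
  reflect : ℕ → ℕ
  reflect i with (P <? i) ×-dec (i ≤? Q)
  ... | yes _ = W ∸ i
  ... | no _ = i

  reflect-in : ∀ {i} → InBlock i → reflect i ≡ W ∸ i
  reflect-in {i} inside with (P <? i) ×-dec (i ≤? Q)
  ... | yes _ = refl
  ... | no outside = ⊥-elim (outside inside)

  reflect-out : ∀ {i} → ¬ InBlock i → reflect i ≡ i
  reflect-out {i} outside with (P <? i) ×-dec (i ≤? Q)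
  ... | yes inside = ⊥-elim (outside inside)
  ... | no _ = refl

  reflect-involutive : ∀ i → reflect (reflect i) ≡ i
  reflect-involutive i with (P <? i) ×-dec (i ≤? Q)
  ... | yes inside = trans (reflect-in (mirror-in-block inside)) (mirror-mirror inside)
  ... | no outside = reflect-out outside

  reflect-bounded : ∀ i → i < suc n → reflect i < suc n
  reflect-bounded i i<N with (P <? i) ×-dec (i ≤? Q)
  ... | yes inside = s≤s (≤-trans (proj₂ (mirror-in-block inside)) Q≤n)
  ... | no _ = i<N

  ρ : Fin (suc n) → Fin (suc n)
  ρ i = fromℕ< (reflect-bounded (toℕ i) (toℕ<n i))

  toℕ-ρ : ∀ i → toℕ (ρ i) ≡ reflect (toℕ i)
  toℕ-ρ i = toℕ-fromℕ< _

  ρ-involutive : ∀ i → ρ (ρ i) ≡ i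
  ρ-involutive i = toℕ-injective (trans (toℕ-ρ (ρ i)) (trans (cong reflect (toℕ-ρ i)) (reflect-involutive (toℕ i))))

  ρ-fixes : ∀ {i} → ¬ InBlock (toℕ i) → ρ i ≡ i
  ρ-fixes {i} outside = toℕ-injective (trans (toℕ-ρ i) (reflect-out outside))

  σ′ : Permutation′ (suc n)
  σ′ = permutation ρ ρ ρ-involutive ρ-involutive ∘ₚ σ C

  successor-outside : ∀ i → toℕ i < P ⊎ Q ≤ toℕ i → ¬ InBlock (toℕ (cyc i))
  successor-outside i (inj₁ i<P) (P<i⁺ , _) =
    <⇒≱ P<i⁺ (subst (_≤ P) (sym (cyc-step i (<-trans i<P P<n))) i<P)
  successor-outside i (inj₂ Q≤i) (P<i⁺ , i⁺≤Q) with cyc-cases i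
  ... | inj₁ i⁺ = <⇒≱ (s≤s Q≤i) (subst (_≤ Q) i⁺ i⁺≤Q)
  ... | inj₂ (_ , i⁺) = <⇒≱ P<i⁺ (subst (_≤ P) (sym i⁺) z≤n)

  link : ∀ {i a b} → ρ i ≡ a → ρ (cyc i) ≡ b → Adj G (σ C ⟨$⟩ʳ a) (σ C ⟨$⟩ʳ b) →
    Adj G (σ′ ⟨$⟩ʳ i) (σ′ ⟨$⟩ʳ cyc i)
  link refl refl ab = ab

  consec-outside : ∀ i → toℕ i < P ⊎ Q < toℕ i → Adj G (σ′ ⟨$⟩ʳ i) (σ′ ⟨$⟩ʳ cyc i)
  consec-outside i out = link (ρ-fixes i-outside) (ρ-fixes (successor-outside i out′)) (consec C i)
    where
    out′ : toℕ i < P ⊎ Q ≤ toℕ i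
    out′ = map₂ <⇒≤ out
    i-outside : ¬ InBlock (toℕ i)
    i-outside (P<i , i≤Q) = [ <-asym P<i , (λ Q<i → <⇒≱ Q<i i≤Q) ] out

  ρ-p : ρ p ≡ p
  ρ-p = ρ-fixes (λ (P<P , _) → <-irrefl refl P<P)

  ρ-p⁺ : ρ (cyc p) ≡ q
  ρ-p⁺ = toℕ-injective (begin
    toℕ (ρ (cyc p))  ≡⟨ toℕ-ρ (cyc p) ⟩
    reflect (toℕ (cyc p)) ≡⟨ cong reflect (cyc-step p P<n) ⟩
    reflect (suc P)  ≡⟨ reflect-in (≤-refl , p<q) ⟩
    W ∸ suc P        ≡⟨ m+n∸m≡n (suc P) Q ⟩
    Q                ∎)
    where open ≡-Reasoning

  ρ-q : ρ q ≡ cyc p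
  ρ-q = toℕ-injective (begin
    toℕ (ρ q)        ≡⟨ toℕ-ρ q ⟩
    reflect Q        ≡⟨ reflect-in (p<q , ≤-refl) ⟩
    W ∸ Q            ≡⟨ m+n∸n≡m (suc P) Q ⟩
    suc P            ≡⟨ cyc-step p P<n ⟨
    toℕ (cyc p)      ∎)
    where open ≡-Reasoning

  -- Inside the block the order is reversed: position i + 1 of the new cycle
  -- holds the predecessor (in C) of the vertex at position i.
  ρ-reverses : ∀ i → P < toℕ i → toℕ i < Q → ρ i ≡ cyc (ρ (cyc i))
  ρ-reverses i P<i i<Q = toℕ-injective positions
    where
    I = toℕ i
    i-inside : InBlock I
    i-inside = P<i , <⇒≤ i<Q
    W∸I≡1+W∸I⁺ : W ∸ I ≡ suc (W ∸ suc I)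
    W∸I≡1+W∸I⁺ = +-∸-assoc 1 (≤-trans i<Q (m≤n+m Q (suc P)))
    ρi⁺ : toℕ (ρ (cyc i)) ≡ W ∸ suc I
    ρi⁺ = begin
      toℕ (ρ (cyc i))        ≡⟨ toℕ-ρ (cyc i) ⟩
      reflect (toℕ (cyc i))  ≡⟨ cong reflect (cyc-step i (<-≤-trans i<Q Q≤n)) ⟩
      reflect (suc I)        ≡⟨ reflect-in (<-trans P<i (n<1+n I) , i<Q) ⟩
      W ∸ suc I              ∎
      where open ≡-Reasoning
    ρi⁺<n : toℕ (ρ (cyc i)) < n
    ρi⁺<n = begin-strict
      toℕ (ρ (cyc i))  ≡⟨ ρi⁺ ⟩
      W ∸ suc I        <⟨ n<1+n _ ⟩
      suc (W ∸ suc I)  ≡⟨ W∸I≡1+W∸I⁺ ⟨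
      W ∸ I            ≤⟨ proj₂ (mirror-in-block i-inside) ⟩
      Q                ≤⟨ Q≤n ⟩
      n                ∎
      where open ≤-Reasoning
    positions : toℕ (ρ i) ≡ toℕ (cyc (ρ (cyc i)))
    positions = begin
      toℕ (ρ i)              ≡⟨ toℕ-ρ i ⟩
      reflect I              ≡⟨ reflect-in i-inside ⟩
      W ∸ I                  ≡⟨ W∸I≡1+W∸I⁺ ⟩
      suc (W ∸ suc I)        ≡⟨ cong suc ρi⁺ ⟨
      suc (toℕ (ρ (cyc i)))  ≡⟨ cyc-step (ρ (cyc i)) ρi⁺<n ⟨
      toℕ (cyc (ρ (cyc i)))  ∎
      where open ≡-Reasoning

  consec′ : ∀ i → Adj G (σ′ ⟨$⟩ʳ i) (σ′ ⟨$⟩ʳ cyc i)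
  consec′ i with <-cmp (toℕ i) P
  ... | tri< i<P _ _ = consec-outside i (inj₁ i<P)
  ... | tri≈ _ i≡P _ = subst (λ j → Adj G (σ′ ⟨$⟩ʳ j) (σ′ ⟨$⟩ʳ cyc j)) (sym (toℕ-injective i≡P))
                             (link ρ-p ρ-p⁺ pq)
  ... | tri> _ _ P<i with <-cmp (toℕ i) Q
  ...   | tri< i<Q _ _ = link (ρ-reverses i P<i i<Q) refl (adj-sym (consec C (ρ (cyc i))))
  ...   | tri≈ _ i≡Q _ = subst (λ j → Adj G (σ′ ⟨$⟩ʳ j) (σ′ ⟨$⟩ʳ cyc j)) (sym (toℕ-injective i≡Q))
                               (link ρ-q (ρ-fixes (successor-outside q (inj₂ ≤-refl))) p⁺q⁺)
  ...   | tri> _ _ Q<i = consec-outside i (inj₂ Q<i)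

  exchanged : HamiltonCycle G
  exchanged = record { three≤n = HamiltonCycle.three≤n C ; σ = σ′ ; consec = consec′ }

  uses-pq : EdgeIn exchanged (σ C ⟨$⟩ʳ p) (σ C ⟨$⟩ʳ q)
  uses-pq = p , inj₁ (cong (σ C ⟨$⟩ʳ_) ρ-p , cong (σ C ⟨$⟩ʳ_) ρ-p⁺)

⟨$⟩ʳ-injective : ∀ {n} (π : Permutation′ n) {i j} → π ⟨$⟩ʳ i ≡ π ⟨$⟩ʳ j → i ≡ j
⟨$⟩ʳ-injective π e = trans (sym (inverseˡ π)) (trans (cong (π ⟨$⟩ˡ_) e) (inverseˡ π))

⟨$⟩ˡ-injective : ∀ {n} (π : Permutation′ n) {a b} → π ⟨$⟩ˡ a ≡ π ⟨$⟩ˡ b → a ≡ b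
⟨$⟩ˡ-injective π e = trans (sym (inverseʳ π)) (trans (cong (π ⟨$⟩ʳ_) e) (inverseʳ π))

EdgeIn-sym : ∀ {n} {G : Graph n} {C : HamiltonCycle G} {a b} → EdgeIn C a b → EdgeIn C b a
EdgeIn-sym (i , inj₁ ends) = i , inj₂ ends
EdgeIn-sym (i , inj₂ ends) = i , inj₁ ends

two-opt : ∀ {n} {G : Graph (suc n)} (C : HamiltonCycle G) {p q : Fin (suc n)} → p ≢ q →
  Adj G (σ C ⟨$⟩ʳ p) (σ C ⟨$⟩ʳ q) → Adj G (σ C ⟨$⟩ʳ cyc p) (σ C ⟨$⟩ʳ cyc q) →
  Σ (HamiltonCycle G) λ C′ → EdgeIn C′ (σ C ⟨$⟩ʳ p) (σ C ⟨$⟩ʳ q)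
two-opt {G = G} C {p} {q} p≢q pq p⁺q⁺ with <-cmp (toℕ p) (toℕ q)
... | tri< p<q _ _ = TwoOpt.exchanged C p q p<q pq p⁺q⁺ , TwoOpt.uses-pq C p q p<q pq p⁺q⁺
... | tri≈ _ p≡q _ = ⊥-elim (p≢q (toℕ-injective p≡q))
... | tri> _ _ q<p = C′ , EdgeIn-sym {C = C′} (TwoOpt.uses-pq C q p q<p qp q⁺p⁺)
  where
  open Neighbourhoods G using (adj-sym)
  qp : Adj G (σ C ⟨$⟩ʳ q) (σ C ⟨$⟩ʳ p)
  qp = adj-sym pq
  q⁺p⁺ : Adj G (σ C ⟨$⟩ʳ cyc q) (σ C ⟨$⟩ʳ cyc p)
  q⁺p⁺ = adj-sym p⁺q⁺
  C′ : HamiltonCycle G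
  C′ = TwoOpt.exchanged C q p q<p qp q⁺p⁺

lemma4 : ∀ {n} (G : Graph n) → IsThreshold G → HamiltonCycle G →
    ∀ (m : ℕ) (δ : ℕ → ℕ) → IsDegreeSeq G m δ →
    ∀ (u v : Fin n) → IsKeyEdge G m δ u v →
    Σ (HamiltonCycle G) λ C → EdgeIn C u v
lemma4 {zero} G _ _ _ _ _ () _ _
lemma4 {suc n} G thr C m δ ds u v (uv , k , 1≤k , k≤⌈m/2⌉ , degrees) =
  subst₂ (λ a b → Σ (HamiltonCycle G) λ C′ → EdgeIn C′ a b) (inverseʳ (σ C)) (inverseʳ (σ C))
    (two-opt C p≢q (at-positions uv)
      (key-edge-closure 1≤k (≤-trans k≤⌈m/2⌉ (⌈n/2⌉≤n m)) degrees ux vy x≢y))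
  where
  open Neighbourhoods G using (adj-irrefl)
  open DegreePartition G thr ds using (key-edge-closure)
  p q : Fin (suc n)
  p = σ C ⟨$⟩ˡ u
  q = σ C ⟨$⟩ˡ v
  x y : Fin (suc n)
  x = σ C ⟨$⟩ʳ cyc p
  y = σ C ⟨$⟩ʳ cyc q
  at-positions : ∀ {a b} → Adj G a b → Adj G (σ C ⟨$⟩ʳ (σ C ⟨$⟩ˡ a)) (σ C ⟨$⟩ʳ (σ C ⟨$⟩ˡ b))
  at-positions = subst₂ (Adj G) (sym (inverseʳ (σ C))) (sym (inverseʳ (σ C)))
  ux : Adj G u x
  ux = subst (λ a → Adj G a x) (inverseʳ (σ C)) (consec C p)
  vy : Adj G v y
  vy = subst (λ a → Adj G a y) (inverseʳ (σ C)) (consec C q)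
  p≢q : p ≢ q
  p≢q p≡q = adj-irrefl uv (⟨$⟩ˡ-injective (σ C) p≡q)
  x≢y : x ≢ y
  x≢y x≡y = p≢q (cyc-injective (⟨$⟩ʳ-injective (σ C) x≡y))
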